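{- For any vocabulary $\tau$ there exists a class $\mathcal C$ of $\tau$-structures that is definable in $\mathrm{MSO}(\mathrm{TC})$ but not definable in order-invariant $\mathrm{MSO}$.
   Context: A vocabulary is a finite set of first-order and second-order variables; a $\tau$-structure is $(A,I)$ with $A$ finite nonempty and $I$ interpreting the variables of $\tau$. $\mathrm{MSO}(\mathrm{TC})$: formulas built by $\varphi ::= x=y \mid X(x_1,\dots,x_k) \mid \neg\varphi \mid (\varphi\lor\varphi) \mid \exists x\,\varphi \mid \exists Y\,\varphi \mid [\mathrm{TC}_{\vec X,\vec X'}\varphi](\vec Y,\vec Y')$ where quantified and TC-bound second-order variables are monadic, $\vec X,\vec X'$ are disjoint tuples of variables of the same sort and $\vec Y,\vec Y'$ of that sort; the TC-formula holds iff $(I(\vec Y),I(\vec Y'))$ lies in the transitive closure of $\{(\vec R,\vec R')\mid\mathfrak A[\vec R/\vec X,\vec R'/\vec X']\models\varphi\}$. With $\tau_\le=\tau\cup\{\le\}$, an $\mathrm{MSO}$-formula over $\tau_\le$ is order-invariant if its truth in any expansion of a $\tau$-structure by a total linear order $\le$ does not depend on the chosen order; a class $\mathcal C$ of $\tau$-structures is definable in order-invariant $\mathrm{MSO}$ if $\{(\mathfrak A,\le)\mid\mathfrak A\in\mathcal C,\ \le\text{ a linear order of }A\}$ is defined by an order-invariant $\mathrm{MSO}$-formula. -}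

module Defs where

open import Data.Bool using (Bool; true; false)
open import Data.Nat using (ℕ; suc)
open import Data.Fin using (Fin)
open import Data.Vec using (Vec; []; _∷_)
import Data.Vec as Vec
open import Data.List using (List; []; _∷_; _++_)
open import Data.List.Membership.Propositional using (_∈_)
open import Data.List.Relation.Unary.All using (All; []; _∷_)
import Data.List.Relation.Unary.All as All
open import Data.List.Relation.Unary.All.Properties using (++⁺)
open import Data.Product using (Σ; _×_; _,_)
open import Data.Sum using (_⊎_)
open import Relation.Nullary using (¬_)
open import Relation.Binary.PropositionalEquality using (_≡_)
open import Relation.Binary.Construct.Closure.Transitive using (TransClosure)
open import Function.Bundles using (_⇔_)

data Sort : Set where
  fo : Sort
  so : ℕ → Sort

data Monadic : Sort → Set where
  fo-mon : Monadic fo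
  so-mon : Monadic (so 1)

-- A vocabulary (and more generally a context of free variables) is a finite
-- list of variables, each given by its sort; variables are referred to by
-- position (well-scoped de Bruijn style), so bound variables are
-- automatically distinct from free ones and from each other.
Vocabulary : Set
Vocabulary = List Sort

Dom : Set → Sort → Set
Dom A fo     = A
Dom A (so k) = Vec A k → Bool

Env : Set → List Sort → Set
Env A Γ = All (Dom A) Γ

-- Syntax.  Fm true Γ  = MSO(TC) formulas with free variables in Γ,
--          Fm false Γ = plain MSO formulas (no TC operator).

data Fm : Bool → List Sort → Set where
  eq   : ∀ {b Γ} → fo ∈ Γ → fo ∈ Γ → Fm b Γ
  rel  : ∀ {b Γ k} → so k ∈ Γ → Vec (fo ∈ Γ) k → Fm b Γ
  neg  : ∀ {b Γ} → Fm b Γ → Fm b Γ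
  or   : ∀ {b Γ} → Fm b Γ → Fm b Γ → Fm b Γ
  ex1  : ∀ {b Γ} → Fm b (fo ∷ Γ) → Fm b Γ
  ex2  : ∀ {b Γ} → Fm b (so 1 ∷ Γ) → Fm b Γ
  -- [TC_{X⃗,X⃗'} φ](Y⃗,Y⃗'): X⃗ and X⃗' are bound tuples of sorts ss (each first
  -- order or monadic); the body φ has free variables X⃗ ++ X⃗' ++ Γ;
  -- Y⃗, Y⃗' are tuples of variables of Γ of the same sorts.
  tc   : ∀ {Γ} (ss : List Sort) → All Monadic ss →
         Fm true (ss ++ (ss ++ Γ)) →
         All (_∈ Γ) ss → All (_∈ Γ) ss → Fm true Γ

lookupVars : ∀ {A : Set} {Γ ss} → Env A Γ → All (_∈ Γ) ss → Env A ss
lookupVars e ys = All.map (All.lookup e) ys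

Sat : ∀ {b Γ} (n : ℕ) → Env (Fin (suc n)) Γ → Fm b Γ → Set
Sat n e (eq x y)   = All.lookup e x ≡ All.lookup e y
Sat n e (rel X xs) = All.lookup e X (Vec.map (All.lookup e) xs) ≡ true
Sat n e (neg φ)    = ¬ Sat n e φ
Sat n e (or φ ψ)   = Sat n e φ ⊎ Sat n e ψ
Sat n e (ex1 φ)    = Σ (Fin (suc n)) λ a → Sat n (a ∷ e) φ
Sat n e (ex2 φ)    = Σ (Vec (Fin (suc n)) 1 → Bool) λ R → Sat n (R ∷ e) φ
Sat n e (tc ss _ φ ys ys') =
  TransClosure (λ u u' → Sat n (++⁺ u (++⁺ u' e)) φ)
               (lookupVars e ys) (lookupVars e ys')

-- τ-structures: a finite nonempty universe (w.l.o.g. Fin (suc n)) and an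
-- interpretation of every variable of τ.

Structure : Vocabulary → Set
Structure τ = Σ ℕ λ n → Env (Fin (suc n)) τ

Class : Vocabulary → Set₁
Class τ = Structure τ → Set

DefinableMSOTC : ∀ {τ} → Class τ → Set
DefinableMSOTC {τ} C =
  Σ (Fm true τ) λ φ → (s : Structure τ) → C s ⇔ Sat (Data.Product.proj₁ s) (Data.Product.proj₂ s) φ

-- Orders.  τ_≤ = τ ∪ {≤}, where ≤ is a fresh binary second-order variable,
-- placed at position 0.

_≤[_]_ : ∀ {A : Set} → A → (Vec A 2 → Bool) → A → Set
a ≤[ R ] b = R (a ∷ b ∷ []) ≡ true

record IsLinearOrder {A : Set} (R : Vec A 2 → Bool) : Set where
  field
    refl′   : ∀ a → a ≤[ R ] a
    antisym : ∀ a b → a ≤[ R ] b → b ≤[ R ] a → a ≡ b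
    trans′  : ∀ a b c → a ≤[ R ] b → b ≤[ R ] c → a ≤[ R ] c
    total   : ∀ a b → a ≤[ R ] b ⊎ b ≤[ R ] a

_≤voc : Vocabulary → Vocabulary
τ ≤voc = so 2 ∷ τ

OrderInvariant : ∀ {τ} → Fm false (τ ≤voc) → Set
OrderInvariant {τ} φ =
  (n : ℕ) (I : Env (Fin (suc n)) τ) (R R' : Vec (Fin (suc n)) 2 → Bool) →
  IsLinearOrder R → IsLinearOrder R' →
  Sat n (R ∷ I) φ ⇔ Sat n (R' ∷ I) φ

DefinableOIMSO : ∀ {τ} → Class τ → Set
DefinableOIMSO {τ} C =
  Σ (Fm false (τ ≤voc)) λ φ → OrderInvariant φ ×
    ((n : ℕ) (I : Env (Fin (suc n)) τ) (R : Vec (Fin (suc n)) 2 → Bool) →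
      IsLinearOrder R → C (n , I) ⇔ Sat n (R ∷ I) φ)

module Submission where

-- The separating class consists of the structures whose size is a triangular number
-- T(k) = 1 + 2 + ⋯ + k.
--
-- It is MSO(TC)-definable: a transitive closure over triples (X, C, S) of sets runs a
-- counter that starts at (∅, ∅, ∅), in each round adds one element to X, and then adds
-- elements to C and S in lockstep until C has caught up with X.  The invariant
-- |S| + |X| = T(|X|) + |C| shows that S can become the whole universe only when its size
-- is triangular.
--
-- It is not definable in order-invariant MSO, not even relative to one fixed order.  On
-- the standard order of Fin (suc n), with every first-order constant at the least element
-- and every relation empty, an MSO formula is evaluated by a finite automaton (Büchi's
-- translation) reading a word a₀ a₁ⁿ, so its truth is ultimately periodic in n; the gaps
-- between consecutive triangular numbers grow without bound.

open import Defs

open import Data.Bool using (Bool; true; false; T; not; _∧_; _∨_)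
open import Data.Bool.Properties using (T-≡; T-∧; T-∨; ¬-not)
open import Data.Fin using (Fin; zero; suc; toℕ; fromℕ<)
import Data.Fin as Fin
open import Data.Fin.Properties
  using (suc-injective; toℕ-injective; toℕ<n; toℕ-fromℕ<; pigeonhole; any?; ⊎⇔∃; 2↔Bool; *↔×)
import Data.Fin.Properties as Fin
open import Data.List using (List; []; _∷_; _++_)
open import Data.List.Membership.Propositional using (_∈_)
open import Data.List.Relation.Unary.Any using (here; there)
open import Data.List.Relation.Unary.All using (All; []; _∷_)
import Data.List.Relation.Unary.All as All
open import Data.List.Relation.Unary.All.Properties using (++⁺)
open import Data.Nat using (ℕ; zero; suc; _+_; _*_; _^_; _≤_; _<_; z≤n; s≤s; _≤?_; _<?_)
open import Data.Nat.Properties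
  using ( _≟_; +-suc; +-assoc; +-comm; +-identityʳ; +-cancelʳ-≡; +-mono-≤; +-monoˡ-≤; +-monoʳ-≤
        ; ≤-trans; ≤-reflexive; <-irrefl; <-≤-trans; <⇒≤; ≰⇒>; n≮0; n≤1+n; n<1+n; m≤m+n; m≤n+m
        ; m<m+n; m<1+n⇒m<n∨m≡n; m≤n⇒∃[o]m+o≡n; module ≤-Reasoning)
  renaming (suc-injective to ℕ-suc-injective)
open import Data.Product using (Σ; _×_; _,_; proj₁; proj₂)
import Data.Product as Product
open import Data.Product.Function.NonDependent.Propositional using (_×-↔_; _×-⇔_)
open import Data.Sum using (_⊎_; inj₁; inj₂)
import Data.Sum as Sum
open import Data.Sum.Function.Propositional using (_⊎-⇔_)
open import Data.Unit using (⊤; tt)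
open import Data.Vec using (Vec; []; _∷_; lookup; tabulate)
import Data.Vec as Vec
open import Data.Vec.Properties using (lookup∘tabulate)
open import Function using (_∘_; id; const)
open import Function.Bundles using (_⇔_; mk⇔; _↔_; mk↔ₛ′; Inverse; Equivalence)
open import Function.Properties.Equivalence using (⇔-setoid)
  renaming (refl to ⇔-refl; sym to ⇔-sym; trans to ⇔-trans)
open import Function.Properties.Inverse using (↔-refl; ↔-sym; ↔-trans)
open import Function.Related.TypeIsomorphisms using (¬-cong-⇔)
open import Level using (0ℓ)
open import Relation.Binary.Construct.Closure.Transitive using (TransClosure; [_]; _∷_; _∷ʳ_)
  renaming (_++_ to _⁺++_)
open import Relation.Binary.PropositionalEquality
  using (_≡_; _≗_; refl; sym; trans; cong; cong₂; subst; subst₂; module ≡-Reasoning)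
import Relation.Binary.Reasoning.Setoid
open import Relation.Nullary using (¬_; Dec; does; yes; no)
open import Relation.Nullary.Decidable using (T?; _×-dec_; _⊎-dec_; decidable-stable)
import Relation.Nullary.Decidable as Decidable
open import Relation.Nullary.Negation using (¬¬-map; negated-stable; contradiction)

open Equivalence using (to; from)

module ⇔-Reasoning = Relation.Binary.Reasoning.Setoid (⇔-setoid 0ℓ)

-- Sat interprets ∧, ⇒ and ∀ through negation, so derived connectives only mean what they
-- should up to double negation; _⇔ᶜ_ (equivalence of the negations) is that equivalence.
infix 2 _⇔ᶜ_

record _⇔ᶜ_ (P Q : Set) : Set where
  constructor mk⇔ᶜ
  field
    to¬   : ¬ P → ¬ Q
    from¬ : ¬ Q → ¬ P

open _⇔ᶜ_

module _ {P Q : Set} where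

  ⇔⇒⇔ᶜ : P ⇔ Q → P ⇔ᶜ Q
  ⇔⇒⇔ᶜ P⇔Q = mk⇔ᶜ (λ ¬p → ¬p ∘ from P⇔Q) (λ ¬q → ¬q ∘ to P⇔Q)

  ⇔ᶜ-sym : P ⇔ᶜ Q → Q ⇔ᶜ P
  ⇔ᶜ-sym P⇔Q = mk⇔ᶜ (from¬ P⇔Q) (to¬ P⇔Q)

  toᶜ : P ⇔ᶜ Q → P → ¬ ¬ Q
  toᶜ P⇔Q p ¬q = from¬ P⇔Q ¬q p

  fromᶜ : P ⇔ᶜ Q → Q → ¬ ¬ P
  fromᶜ P⇔Q q ¬p = to¬ P⇔Q ¬p q

⇔ᶜ-refl : ∀ {P} → P ⇔ᶜ P
⇔ᶜ-refl = ⇔⇒⇔ᶜ ⇔-refl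

⇔ᶜ-trans : ∀ {P Q R} → P ⇔ᶜ Q → Q ⇔ᶜ R → P ⇔ᶜ R
⇔ᶜ-trans P⇔Q Q⇔R = mk⇔ᶜ (to¬ Q⇔R ∘ to¬ P⇔Q) (from¬ P⇔Q ∘ from¬ Q⇔R)

module _ {P P′ Q Q′ : Set} where

  ⊎-congᶜ : P ⇔ᶜ P′ → Q ⇔ᶜ Q′ → (P ⊎ Q) ⇔ᶜ (P′ ⊎ Q′)
  ⊎-congᶜ P⇔P′ Q⇔Q′ = mk⇔ᶜ
    (λ ¬p⊎q → Sum.[ to¬ P⇔P′ (¬p⊎q ∘ inj₁) , to¬ Q⇔Q′ (¬p⊎q ∘ inj₂) ])
    (λ ¬p′⊎q′ → Sum.[ from¬ P⇔P′ (¬p′⊎q′ ∘ inj₁) , from¬ Q⇔Q′ (¬p′⊎q′ ∘ inj₂) ])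

  ×-congᶜ : P ⇔ᶜ P′ → Q ⇔ᶜ Q′ → (P × Q) ⇔ᶜ (P′ × Q′)
  ×-congᶜ P⇔P′ Q⇔Q′ = mk⇔ᶜ (transfer P⇔P′ Q⇔Q′) (transfer (⇔ᶜ-sym P⇔P′) (⇔ᶜ-sym Q⇔Q′))
    where
    transfer : ∀ {A A′ B B′} → A ⇔ᶜ A′ → B ⇔ᶜ B′ → ¬ (A × B) → ¬ (A′ × B′)
    transfer A⇔A′ B⇔B′ ¬a×b (a′ , b′) = to¬ A⇔A′ (λ a → to¬ B⇔B′ (λ b → ¬a×b (a , b)) b′) a′

Σ-congᶜ : ∀ {A : Set} {P Q : A → Set} → (∀ a → P a ⇔ᶜ Q a) → Σ A P ⇔ᶜ Σ A Q
Σ-congᶜ P⇔Q = mk⇔ᶜ (λ ¬∃p (a , q) → to¬ (P⇔Q a) (λ p → ¬∃p (a , p)) q)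
                   (λ ¬∃q (a , p) → from¬ (P⇔Q a) (λ q → ¬∃q (a , q)) p)

¬¬-∀-Fin : ∀ {k} {P : Fin k → Set} → (∀ a → ¬ ¬ P a) → ¬ ¬ (∀ a → P a)
¬¬-∀-Fin {zero}  ¬¬p ¬∀p = ¬∀p λ ()
¬¬-∀-Fin {suc k} ¬¬p ¬∀p = ¬¬p zero λ p₀ → ¬¬-∀-Fin (¬¬p ∘ suc) λ p₊ →
  ¬∀p λ { zero → p₀ ; (suc a) → p₊ a }

∀-Fin-congᶜ : ∀ {k} {P Q : Fin k → Set} → (∀ a → P a ⇔ᶜ Q a) → (∀ a → P a) ⇔ᶜ (∀ a → Q a)
∀-Fin-congᶜ P⇔Q = mk⇔ᶜ (transfer (to¬ ∘ P⇔Q)) (transfer (from¬ ∘ P⇔Q))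
  where
  transfer : ∀ {A B : Fin _ → Set} → (∀ a → ¬ A a → ¬ B a) → ¬ (∀ a → A a) → ¬ (∀ a → B a)
  transfer ¬A⇒¬B ¬∀a ∀b = ¬¬-∀-Fin (λ a ¬a → ¬A⇒¬B a ¬a (∀b a)) ¬∀a

module _ {P Q : Set} where

  ¬⊎¬⇔ᶜ× : ¬ (¬ P ⊎ ¬ Q) ⇔ᶜ (P × Q)
  ¬⊎¬⇔ᶜ× = mk⇔ᶜ
    (λ ¬¬[¬p⊎¬q] (p , q) → ¬¬[¬p⊎¬q] Sum.[ (λ ¬p → ¬p p) , (λ ¬q → ¬q q) ])
    (λ ¬p×q ¬[¬p⊎¬q] → ¬[¬p⊎¬q] (inj₁ λ p → ¬[¬p⊎¬q] (inj₂ λ q → ¬p×q (p , q))))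

  ¬⊎⇔ᶜ→ : (¬ P ⊎ Q) ⇔ᶜ (P → Q)
  ¬⊎⇔ᶜ→ = mk⇔ᶜ
    (λ ¬[¬p⊎q] p⇒q → ¬[¬p⊎q] (inj₁ λ p → ¬[¬p⊎q] (inj₂ (p⇒q p))))
    (λ ¬[p⇒q] ¬p⊎q → ¬[p⇒q] λ p → Sum.[ contradiction p , id ] ¬p⊎q)

¬⊎¬-congᶜ : ∀ {P P′ Q Q′} → P ⇔ᶜ P′ → Q ⇔ᶜ Q′ → ¬ (¬ P ⊎ ¬ Q) ⇔ᶜ (P′ × Q′)
¬⊎¬-congᶜ P⇔P′ Q⇔Q′ = ⇔ᶜ-trans ¬⊎¬⇔ᶜ× (×-congᶜ P⇔P′ Q⇔Q′)

¬∃¬⇔ᶜ∀ : ∀ {k} {P : Fin k → Set} → ¬ Σ (Fin k) (¬_ ∘ P) ⇔ᶜ (∀ a → P a)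
¬∃¬⇔ᶜ∀ = mk⇔ᶜ (λ ¬¬∃¬p ∀p → ¬¬∃¬p λ (a , ¬p) → ¬p (∀p a))
              (λ ¬∀p ¬∃¬p → ¬¬-∀-Fin (λ a ¬p → ¬∃¬p (a , ¬p)) ¬∀p)

≡⇒⇔ : ∀ {A B : Set} → A ≡ B → A ⇔ B
≡⇒⇔ refl = ⇔-refl

Σ-cong′ : ∀ {A : Set} {P Q : A → Set} → (∀ a → P a ⇔ Q a) → Σ A P ⇔ Σ A Q
Σ-cong′ P⇔Q = mk⇔ (Product.map₂ (to (P⇔Q _))) (Product.map₂ (from (P⇔Q _)))

T-not : ∀ {b} → T (not b) ⇔ (¬ T b)
T-not {false} = mk⇔ (λ _ ()) (λ _ → _)
T-not {true}  = mk⇔ (λ ()) (λ ¬t → ¬t _)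

T-does : ∀ {P : Set} (P? : Dec P) → T (does P?) ⇔ P
T-does (yes p) = mk⇔ (λ _ → p) (λ _ → _)
T-does (no ¬p) = mk⇔ (λ ()) ¬p

Σ-Bool? : ∀ {P : Bool → Set} → Dec (P true) → Dec (P false) → Dec (Σ Bool P)
Σ-Bool? P-true? P-false? = Decidable.map
  (mk⇔ Sum.[ (true ,_) , (false ,_) ] λ { (true , p) → inj₁ p ; (false , p) → inj₂ p })
  (P-true? ⊎-dec P-false?)

true-⇔⇒≡ : ∀ {b b′} → (b ≡ true ⇔ b′ ≡ true) → b ≡ b′
true-⇔⇒≡ {false} {false} _    = refl
true-⇔⇒≡ {false} {true}  b⇔b′ = from b⇔b′ refl
true-⇔⇒≡ {true}  {_}     b⇔b′ = sym (to b⇔b′ refl)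

indicator : Bool → ℕ
indicator false = 0
indicator true  = 1

count : ∀ {m} → (Fin m → Bool) → ℕ
count {zero}  h = 0
count {suc m} h = indicator (h zero) + count (h ∘ suc)

count-cong : ∀ {m} {h h′ : Fin m → Bool} → (∀ a → h a ≡ true ⇔ h′ a ≡ true) → count h ≡ count h′
count-cong {zero}  h⇔h′ = refl
count-cong {suc m} h⇔h′ =
  cong₂ _+_ (cong indicator (true-⇔⇒≡ (h⇔h′ zero))) (count-cong (h⇔h′ ∘ suc))

count-none : ∀ {m} {h : Fin m → Bool} → (∀ a → ¬ h a ≡ true) → count h ≡ 0
count-none {zero}  _  = refl
count-none {suc m} ¬h rewrite ¬-not (¬h zero) = count-none (¬h ∘ suc)

count-all : ∀ {m} {h : Fin m → Bool} → (∀ a → h a ≡ true) → count h ≡ m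
count-all {zero}  _     = refl
count-all {suc m} h-all rewrite h-all zero = cong suc (count-all (h-all ∘ suc))

count-insert : ∀ {m} {h h′ : Fin m → Bool} {c} →
               (∀ a → h′ a ≡ true ⇔ (h a ≡ true ⊎ a ≡ c)) → ¬ h c ≡ true → count h′ ≡ suc (count h)
count-insert {suc m} {h} {h′} {zero} h′⇔h+c c∉h
  rewrite from (h′⇔h+c zero) (inj₂ refl) | ¬-not c∉h = cong suc (count-cong λ a → mk⇔
    (Sum.[ id , (λ ()) ] ∘ to (h′⇔h+c (suc a)))
    (from (h′⇔h+c (suc a)) ∘ inj₁))
count-insert {suc m} {h} {h′} {suc c} h′⇔h+c c∉h =
  trans (cong₂ _+_ (cong indicator (true-⇔⇒≡ head⇔)) (count-insert tail⇔ c∉h))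
        (+-suc (indicator (h zero)) _)
  where
  head⇔ : h′ zero ≡ true ⇔ h zero ≡ true
  head⇔ = mk⇔ (Sum.[ id , (λ ()) ] ∘ to (h′⇔h+c zero)) (from (h′⇔h+c zero) ∘ inj₁)
  tail⇔ : ∀ a → h′ (suc a) ≡ true ⇔ (h (suc a) ≡ true ⊎ a ≡ c)
  tail⇔ a = mk⇔ (Sum.map₂ suc-injective ∘ to (h′⇔h+c (suc a)))
                (from (h′⇔h+c (suc a)) ∘ Sum.map₂ (cong suc))

count≡0⇒none : ∀ {m} {h : Fin m → Bool} → count h ≡ 0 → ∀ a → ¬ h a ≡ true
count≡0⇒none {suc m} {h} count≡0 a ha with h zero in h₀
count≡0⇒none {suc m} {h} ()      a       ha | true
count≡0⇒none {suc m} {h} count≡0 zero    ha | false = contradiction (trans (sym h₀) ha) λ ()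
count≡0⇒none {suc m} {h} count≡0 (suc a) ha | false = count≡0⇒none count≡0 a ha

count≡1⇒singleton : ∀ {m} {h : Fin m → Bool} → count h ≡ 1 →
                    Σ (Fin m) λ c → ∀ a → h a ≡ true ⇔ a ≡ c
count≡1⇒singleton {suc m} {h} count≡1 with h zero in h₀
... | true  = zero , λ where
  zero    → mk⇔ (λ _ → refl) (λ _ → h₀)
  (suc a) → mk⇔ (λ ha → contradiction ha (count≡0⇒none (ℕ-suc-injective count≡1) a)) λ ()
... | false with count≡1⇒singleton {h = h ∘ suc} count≡1
... | c , tail⇔ = suc c , λ where
  zero    → mk⇔ (λ h₀′ → contradiction (trans (sym h₀) h₀′) λ ()) λ ()
  (suc a) → mk⇔ (cong suc ∘ to (tail⇔ a)) (from (tail⇔ a) ∘ suc-injective)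

count-singleton : ∀ {m} {h : Fin m → Bool} {c} → (∀ a → h a ≡ true ⇔ a ≡ c) → count h ≡ 1
count-singleton {m} {h} {c} h⇔c = trans
  (count-insert {h = λ _ → false} (λ a → mk⇔ (inj₂ ∘ to (h⇔c a)) Sum.[ (λ ()) , from (h⇔c a) ]) λ ())
  (cong suc (count-none {m} {λ _ → false} λ _ ()))

triangle : ℕ → ℕ
triangle zero    = 0
triangle (suc k) = suc k + triangle k

Triangular : ℕ → Set
Triangular n = Σ ℕ λ k → n ≡ triangle k

triangle-mono-≤ : ∀ {k l} → k ≤ l → triangle k ≤ triangle l
triangle-mono-≤ z≤n       = z≤n
triangle-mono-≤ (s≤s k≤l) = s≤s (+-mono-≤ k≤l (triangle-mono-≤ k≤l))

between-triangles-not-triangular : ∀ {k n} → triangle k < n → n < triangle (suc k) → ¬ Triangular n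
between-triangles-not-triangular {k} lower upper (l , refl) with l ≤? k
... | yes l≤k = <-irrefl refl (<-≤-trans lower (triangle-mono-≤ l≤k))
... | no  l≰k = <-irrefl refl (<-≤-trans upper (triangle-mono-≤ (≰⇒> l≰k)))

UltimatelyPeriodic : (ℕ → Set) → Set
UltimatelyPeriodic P = Σ ℕ λ N → Σ ℕ λ p → 0 < p × (∀ n → N ≤ n → P n ⇔ P (n + p))

ultimatelyPeriodic-cong : ∀ {P Q : ℕ → Set} → (∀ n → P n ⇔ Q n) →
                          UltimatelyPeriodic Q → UltimatelyPeriodic P
ultimatelyPeriodic-cong P⇔Q (N , p , 0<p , periodic) = N , p , 0<p , λ n N≤n →
  ⇔-trans (P⇔Q n) (⇔-trans (periodic n N≤n) (⇔-sym (P⇔Q (n + p))))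

-- Take K = N + p and n + 1 = T(K + 1); then n + 1 + p lies strictly between T(K + 1) and T(K + 2).
triangular-not-ultimatelyPeriodic : ¬ UltimatelyPeriodic (Triangular ∘ suc)
triangular-not-ultimatelyPeriodic (N , p , 0<p , periodic) =
  between-triangles-not-triangular lower upper (to (periodic n N≤n) (suc K , refl))
  where
  K = N + p
  n = K + triangle K
  N≤n : N ≤ n
  N≤n = ≤-trans (m≤m+n N p) (m≤m+n K (triangle K))
  lower : triangle (suc K) < suc (n + p)
  lower = s≤s (m<m+n n 0<p)
  upper : suc (n + p) < triangle (suc (suc K))
  upper = s≤s (s≤s (begin
    n + p      ≡⟨ +-comm n p ⟩
    p + n      ≤⟨ +-monoˡ-≤ n (m≤n+m p N) ⟩
    K + n      ≤⟨ +-monoʳ-≤ K (n≤1+n n) ⟩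
    K + suc n  ∎))
    where open ≤-Reasoning

-- Finite automata

record DFA (L : Set) : Set₁ where
  field
    State     : Set
    size      : ℕ
    index     : State ↔ Fin size
    start     : State
    step      : State → L → State
    accepting : State → Bool

open DFA

Word : Set → ℕ → Set
Word L m = Fin m → L

module _ {L : Set} (A : DFA L) where

  run : ∀ {m} → State A → Word L m → State A
  run {zero}  s w = s
  run {suc m} s w = run (step A s (w zero)) (w ∘ suc)

  Accepts : ∀ {m} → Word L m → Set
  Accepts w = T (accepting A (run (start A) w))

  run-cong : ∀ {m} s {w w′ : Word L m} → (∀ i → w i ≡ w′ i) → run s w ≡ run s w′
  run-cong {zero}  s w≗w′ = refl
  run-cong {suc m} s w≗w′ rewrite w≗w′ zero = run-cong _ (w≗w′ ∘ suc)

  index-injective : ∀ {s s′} → Inverse.to (index A) s ≡ Inverse.to (index A) s′ → s ≡ s′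
  index-injective {s} {s′} same = begin
    s                                         ≡⟨ sym (from∘to s) ⟩
    Inverse.from (index A) (Inverse.to (index A) s)  ≡⟨ cong (Inverse.from (index A)) same ⟩
    Inverse.from (index A) (Inverse.to (index A) s′) ≡⟨ from∘to s′ ⟩
    s′                                        ∎
    where
    open ≡-Reasoning
    open Inverse (index A) using () renaming (strictlyInverseʳ to from∘to)

  module _ (a : L) where

    iterate : State A → ℕ → State A
    iterate q n = run {n} q (const a)

    iterate-+ : ∀ q k l → iterate q (k + l) ≡ iterate (iterate q k) l
    iterate-+ q zero    l = refl
    iterate-+ q (suc k) l = iterate-+ (step A q a) k l

    iterate-repeats : ∀ q → Σ ℕ λ i → Σ ℕ λ p → 0 < p × iterate q i ≡ iterate q (i + p)
    iterate-repeats q with pigeonhole (n<1+n (size A)) (Inverse.to (index A) ∘ iterate q ∘ toℕ)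
    ... | i , j , i<j , same-index with m≤n⇒∃[o]m+o≡n i<j
    ... | k , 1+i+k≡j = toℕ i , suc k , s≤s z≤n ,
      trans (index-injective same-index) (cong (iterate q) (trans (sym 1+i+k≡j) (sym (+-suc (toℕ i) k))))

    iterate-periodic : ∀ q {i p} → iterate q i ≡ iterate q (i + p) →
                       ∀ t → iterate q (i + t) ≡ iterate q (i + t + p)
    iterate-periodic q {i} {p} repeat t = begin
      iterate q (i + t)              ≡⟨ iterate-+ q i t ⟩
      iterate (iterate q i) t        ≡⟨ cong (λ r → iterate r t) repeat ⟩
      iterate (iterate q (i + p)) t  ≡⟨ sym (iterate-+ q (i + p) t) ⟩
      iterate q (i + p + t)          ≡⟨ cong (iterate q) (+-assoc i p t) ⟩
      iterate q (i + (p + t))        ≡⟨ cong (λ r → iterate q (i + r)) (+-comm p t) ⟩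
      iterate q (i + (t + p))        ≡⟨ cong (iterate q) (sym (+-assoc i t p)) ⟩
      iterate q (i + t + p)          ∎
      where open ≡-Reasoning

    ultimatelyPeriodic-iterate : ∀ q → UltimatelyPeriodic (λ n → T (accepting A (iterate q n)))
    ultimatelyPeriodic-iterate q with iterate-repeats q
    ... | i , p , 0<p , repeat = i , p , 0<p , periodic
      where
      periodic : ∀ n → i ≤ n → T (accepting A (iterate q n)) ⇔ T (accepting A (iterate q (n + p)))
      periodic n i≤n with m≤n⇒∃[o]m+o≡n i≤n
      ... | t , refl = ≡⇒⇔ (cong (T ∘ accepting A) (iterate-periodic q {i} {p} repeat t))

module _ {L : Set} where

  complement : DFA L → DFA L
  complement A = record A { accepting = not ∘ accepting A }

  run-complement : ∀ (A : DFA L) {m} s (w : Word L m) → run (complement A) s w ≡ run A s w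
  run-complement A {zero}  s w = refl
  run-complement A {suc m} s w = run-complement A _ (w ∘ suc)

  accepts-complement : ∀ A {m} (w : Word L m) → Accepts (complement A) w ⇔ (¬ Accepts A w)
  accepts-complement A w rewrite run-complement A (start A) w = T-not

  product : (Bool → Bool → Bool) → DFA L → DFA L → DFA L
  product _⊕_ A B = record
    { State     = State A × State B
    ; size      = size A * size B
    ; index     = ↔-trans (index A ×-↔ index B) (↔-sym *↔×)
    ; start     = start A , start B
    ; step      = λ (s , t) l → step A s l , step B t l
    ; accepting = λ (s , t) → accepting A s ⊕ accepting B t
    }

  run-product : ∀ _⊕_ A B {m} s t (w : Word L m) → run (product _⊕_ A B) (s , t) w ≡ (run A s w , run B t w)
  run-product _⊕_ A B {zero}  s t w = refl
  run-product _⊕_ A B {suc m} s t w = run-product _⊕_ A B _ _ (w ∘ suc)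

  accepts-union : ∀ A B {m} (w : Word L m) → Accepts (product _∨_ A B) w ⇔ (Accepts A w ⊎ Accepts B w)
  accepts-union A B w rewrite run-product _∨_ A B (start A) (start B) w = T-∨

  accepts-intersection : ∀ A B {m} (w : Word L m) → Accepts (product _∧_ A B) w ⇔ (Accepts A w × Accepts B w)
  accepts-intersection A B w rewrite run-product _∧_ A B (start A) (start B) w = T-∧

  module _ (p q : L → Bool) where

    ordered : DFA L
    ordered = record
      { State     = Bool × Bool
      ; size      = 2 * 2
      ; index     = ↔-trans (↔-sym 2↔Bool ×-↔ ↔-sym 2↔Bool) (↔-sym *↔×)
      ; start     = false , false
      ; step      = λ (seen , found) l → seen ∨ p l , found ∨ ((seen ∨ p l) ∧ q l)
      ; accepting = proj₂
      }

    SeenBy : ∀ {m} → Bool → Word L m → Fin m → Set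
    SeenBy seen w j = T seen ⊎ Σ (Fin _) λ i → i Fin.≤ j × T (p (w i))

    seenBy-zero : ∀ {m} seen (w : Word L (suc m)) → T (seen ∨ p (w zero)) ⇔ SeenBy seen w zero
    seenBy-zero seen w =
      ⇔-trans T-∨ (⇔-refl ⊎-⇔ mk⇔ (λ pw₀ → zero , z≤n , pw₀) λ { (zero , _ , pw₀) → pw₀ })

    seenBy-suc : ∀ {m} seen (w : Word L (suc m)) j →
                 SeenBy (seen ∨ p (w zero)) (w ∘ suc) j ⇔ SeenBy seen w (suc j)
    seenBy-suc seen w j = mk⇔ forward backward
      where
      forward : SeenBy (seen ∨ p (w zero)) (w ∘ suc) j → SeenBy seen w (suc j)
      forward (inj₁ seen′)           = Sum.map₂ (λ pw₀ → zero , z≤n , pw₀) (to T-∨ seen′)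
      forward (inj₂ (i , i≤j , pwi)) = inj₂ (suc i , s≤s i≤j , pwi)
      backward : SeenBy seen w (suc j) → SeenBy (seen ∨ p (w zero)) (w ∘ suc) j
      backward (inj₁ seen₀)                   = inj₁ (from T-∨ (inj₁ seen₀))
      backward (inj₂ (zero , _ , pw₀))        = inj₁ (from T-∨ (inj₂ pw₀))
      backward (inj₂ (suc i , s≤s i≤j , pwi)) = inj₂ (i , i≤j , pwi)

    run-ordered : ∀ {m} seen found (w : Word L m) →
      T (proj₂ (run ordered (seen , found) w)) ⇔ (T found ⊎ Σ (Fin m) λ j → SeenBy seen w j × T (q (w j)))
    run-ordered {zero}  seen found w = mk⇔ inj₁ Sum.[ id , (λ ()) ]
    run-ordered {suc m} seen found w = begin
      T (proj₂ (run ordered (seen′ , found ∨ (seen′ ∧ q (w zero))) (w ∘ suc)))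
        ≈⟨ run-ordered seen′ _ (w ∘ suc) ⟩
      (T (found ∨ (seen′ ∧ q (w zero))) ⊎ Σ (Fin m) λ j → SeenBy seen′ (w ∘ suc) j × T (q (w (suc j))))
        ≈⟨ ⇔-trans T-∨ (⇔-refl ⊎-⇔ ⇔-trans T-∧ (seenBy-zero seen w ×-⇔ ⇔-refl))
             ⊎-⇔ Σ-cong′ (λ j → seenBy-suc seen w j ×-⇔ ⇔-refl) ⟩
      ((T found ⊎ Here) ⊎ Σ (Fin m) λ j → SeenBy seen w (suc j) × T (q (w (suc j))))
        ≈⟨ mk⇔ Sum.assocʳ Sum.assocˡ ⟩
      (T found ⊎ (Here ⊎ Σ (Fin m) λ j → SeenBy seen w (suc j) × T (q (w (suc j)))))
        ≈⟨ ⇔-refl ⊎-⇔ ⊎⇔∃ ⟩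
      (T found ⊎ Σ (Fin (suc m)) λ j → SeenBy seen w j × T (q (w j)))
        ∎
      where
      open ⇔-Reasoning
      seen′ = seen ∨ p (w zero)
      Here = SeenBy seen w zero × T (q (w zero))

    accepts-ordered : ∀ {m} (w : Word L m) →
      Accepts ordered w ⇔ (Σ (Fin m) λ i → Σ (Fin m) λ j → i Fin.≤ j × T (p (w i)) × T (q (w j)))
    accepts-ordered w = mk⇔
      (Sum.[ (λ ()) , (λ { (j , inj₂ (i , i≤j , pwi) , qwj) → i , j , i≤j , pwi , qwj }) ]
        ∘ to (run-ordered false false w))
      (λ (i , j , i≤j , pwi , qwj) →
         from (run-ordered false false w) (inj₂ (j , inj₂ (i , i≤j , pwi) , qwj)))

  module _ (p : L → Bool) where

    somewhere : DFA L
    somewhere = ordered p p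

    accepts-somewhere : ∀ {m} (w : Word L m) → Accepts somewhere w ⇔ Σ (Fin m) λ i → T (p (w i))
    accepts-somewhere w = ⇔-trans (accepts-ordered p p w)
      (mk⇔ (λ (i , _ , _ , pwi , _) → i , pwi) (λ (i , pwi) → i , i , Fin.≤-refl , pwi , pwi))

    saturate : ℕ → Fin 3
    saturate 0             = zero
    saturate 1             = suc zero
    saturate (suc (suc _)) = suc (suc zero)

    isOne : Fin 3 → Bool
    isOne (suc zero) = true
    isOne _          = false

    exactlyOne : DFA L
    exactlyOne = record
      { State     = Fin 3
      ; size      = 3
      ; index     = ↔-refl
      ; start     = zero
      ; step      = λ c l → saturate (toℕ c + indicator (p l))
      ; accepting = isOne
      }

    saturate-+ : ∀ k n → saturate (toℕ (saturate k) + n) ≡ saturate (k + n)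
    saturate-+ 0             n       = refl
    saturate-+ 1             n       = refl
    saturate-+ (suc (suc k)) zero    = refl
    saturate-+ (suc (suc k)) (suc n) = refl

    run-exactlyOne : ∀ {m} k (w : Word L m) → run exactlyOne (saturate k) w ≡ saturate (k + count (p ∘ w))
    run-exactlyOne {zero}  k w = cong saturate (sym (+-identityʳ k))
    run-exactlyOne {suc m} k w = begin
      run exactlyOne (saturate (toℕ (saturate k) + indicator (p (w zero)))) (w ∘ suc)
        ≡⟨ cong (λ c → run exactlyOne c (w ∘ suc)) (saturate-+ k _) ⟩
      run exactlyOne (saturate (k + indicator (p (w zero)))) (w ∘ suc)
        ≡⟨ run-exactlyOne _ (w ∘ suc) ⟩
      saturate (k + indicator (p (w zero)) + count (p ∘ w ∘ suc))
        ≡⟨ cong saturate (+-assoc k _ _) ⟩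
      saturate (k + count (p ∘ w))
        ∎
      where open ≡-Reasoning

    isOne-saturate : ∀ k → T (isOne (saturate k)) ⇔ k ≡ 1
    isOne-saturate 0             = mk⇔ (λ ()) (λ ())
    isOne-saturate 1             = mk⇔ (λ _ → refl) (λ _ → _)
    isOne-saturate (suc (suc k)) = mk⇔ (λ ()) (λ ())

    accepts-exactlyOne : ∀ {m} (w : Word L m) → Accepts exactlyOne w ⇔ count (p ∘ w) ≡ 1
    accepts-exactlyOne w rewrite run-exactlyOne 0 w = isOne-saturate (count (p ∘ w))

subsets↔ : ∀ n → Vec Bool n ↔ Fin (2 ^ n)
subsets↔ zero    = mk↔ₛ′ (λ _ → zero) (λ _ → []) (λ { zero → refl }) (λ { [] → refl })
subsets↔ (suc n) = ↔-trans cons↔ (↔-trans (↔-sym 2↔Bool ×-↔ subsets↔ n) (↔-sym *↔×))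
  where
  cons↔ : Vec Bool (suc n) ↔ (Bool × Vec Bool n)
  cons↔ = mk↔ₛ′ (λ { (b ∷ bs) → b , bs }) (λ (b , bs) → b ∷ bs) (λ _ → refl) (λ { (_ ∷ _) → refl })

Marked : ∀ {L L′ m} → (Bool → L → L′) → (Fin m → Bool) → Word L m → Word L′ m
Marked extend g w i = extend (g i) (w i)

-- The subset construction for the automaton that guesses one extra bit at every position.
module _ {L L′ : Set} (extend : Bool → L → L′) (A : DFA L′) where

  private
    N = size A
    open Inverse (index A) using ()
      renaming (to to idx; from to state; strictlyInverseˡ to idx∘state; strictlyInverseʳ to state∘idx)

  Reachable : Vec Bool N → State A → Set
  Reachable P s = T (lookup P (idx s))

  Σ-index : ∀ {Q : Fin N → Set} → Σ (Fin N) Q ⇔ Σ (State A) (Q ∘ idx)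
  Σ-index {Q} = mk⇔ (λ (c , q) → state c , subst Q (sym (idx∘state c)) q) (λ (s , q) → idx s , q)

  idx-≡ : ∀ {s s′} → idx s ≡ idx s′ ⇔ s ≡ s′
  idx-≡ = mk⇔ (index-injective A) (cong idx)

  Successor : Vec Bool N → L → Fin N → Set
  Successor P l t = Σ (Fin N) λ c → T (lookup P c) × Σ Bool λ b → idx (step A (state c) (extend b l)) ≡ t

  successor? : ∀ P l t → Dec (Successor P l t)
  successor? P l t = any? λ c → T? (lookup P c) ×-dec Σ-Bool? (idx (step A (state c) (extend true l)) Fin.≟ t)
                                                              (idx (step A (state c) (extend false l)) Fin.≟ t)

  project : DFA L
  project = record
    { State     = Vec Bool N
    ; size      = 2 ^ N
    ; index     = subsets↔ N
    ; start     = tabulate λ c → does (c Fin.≟ idx (start A))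
    ; step      = λ P l → tabulate λ t → does (successor? P l t)
    ; accepting = λ P → does (any? λ c → T? (lookup P c ∧ accepting A (state c)))
    }

  reachable-start : ∀ s → Reachable (start project) s ⇔ s ≡ start A
  reachable-start s rewrite lookup∘tabulate (λ c → does (c Fin.≟ idx (start A))) (idx s) =
    ⇔-trans (T-does (idx s Fin.≟ idx (start A))) idx-≡

  reachable-step : ∀ P l s′ → Reachable (step project P l) s′ ⇔
                   Σ (State A) λ s → Reachable P s × Σ Bool λ b → step A s (extend b l) ≡ s′
  reachable-step P l s′ rewrite lookup∘tabulate (λ t → does (successor? P l t)) (idx s′) =
    ⇔-trans (T-does (successor? P l (idx s′)))
            (⇔-trans Σ-index (Σ-cong′ λ s → ⇔-refl ×-⇔ Σ-cong′ λ b → same-successor s b))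
    where
    same-successor : ∀ s b → idx (step A (state (idx s)) (extend b l)) ≡ idx s′ ⇔ step A s (extend b l) ≡ s′
    same-successor s b rewrite state∘idx s = idx-≡

  T-accepting-project : ∀ P → T (accepting project P) ⇔ Σ (State A) λ s → Reachable P s × T (accepting A s)
  T-accepting-project P = ⇔-trans (T-does (any? _)) (⇔-trans Σ-index (Σ-cong′ reachable-accepting))
    where
    reachable-accepting : ∀ s → T (lookup P (idx s) ∧ accepting A (state (idx s))) ⇔
                                (Reachable P s × T (accepting A s))
    reachable-accepting s rewrite state∘idx s = T-∧

  reachable-run : ∀ {m} P (w : Word L m) s′ → Reachable (run project P w) s′ ⇔
                  Σ (State A) λ s → Reachable P s × Σ (Fin m → Bool) λ g → run A s (Marked extend g w) ≡ s′
  reachable-run {zero}  P w s′ = mk⇔ (λ r → s′ , r , (λ ()) , refl) (λ { (s , r , _ , refl) → r })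
  reachable-run {suc m} P w s′ = mk⇔ forward backward
    where
    IH = reachable-run (step project P (w zero)) (w ∘ suc) s′
    Witness = Σ (State A) λ s → Reachable P s ×
                Σ (Fin (suc m) → Bool) λ g → run A s (Marked extend g w) ≡ s′
    forward : Reachable (run project P w) s′ → Witness
    forward r with to IH r
    ... | s₁ , r₁ , g , run≡ with to (reachable-step P (w zero) s₁) r₁
    ... | s , r₀ , b , refl = s , r₀ , (λ { zero → b ; (suc i) → g i }) , run≡
    backward : Witness → Reachable (run project P w) s′
    backward (s , r , g , run≡) = from IH (step A s (extend (g zero) (w zero)) ,
      from (reachable-step P (w zero) _) (s , r , g zero , refl) , g ∘ suc , run≡)

  accepts-project : ∀ {m} (w : Word L m) →
                    Accepts project w ⇔ Σ (Fin m → Bool) λ g → Accepts A (Marked extend g w)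
  accepts-project w = mk⇔ forward backward
    where
    final = run project (start project) w
    forward : Accepts project w → Σ _ λ g → Accepts A (Marked extend g w)
    forward accepted with to (T-accepting-project final) accepted
    ... | s , r , accepting-s with to (reachable-run _ w s) r
    ... | s₀ , r₀ , g , refl with to (reachable-start s₀) r₀
    ... | refl = g , accepting-s
    backward : (Σ _ λ g → Accepts A (Marked extend g w)) → Accepts project w
    backward (g , accepted) = from (T-accepting-project final)
      (_ , from (reachable-run _ w _) (start A , from (reachable-start _) refl , g , refl) , accepted)

-- From MSO formulas to automata

-- How a variable is read off the word: a point or a set contributes its characteristic
-- bit at every position, while the order is assumed to be the standard one and every other
-- relation to be empty, so those contribute nothing.
data Role : Sort → Set where
  point : Role fo
  set   : Role (so 1)
  order : Role (so 2)
  empty : ∀ k → Role (so k)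

Letter : List Sort → Set
Letter Γ = All (const Bool) Γ

marker : ∀ {m} → Fin m → Fin m → Bool
marker a i = does (a Fin.≟ i)

marker-true : ∀ {m} {a i : Fin m} → marker a i ≡ true ⇔ i ≡ a
marker-true {a = a} {i} = ⇔-trans (⇔-sym T-≡) (⇔-trans (T-does (a Fin.≟ i)) (mk⇔ sym sym))

bit : ∀ {m s} → Role s → Dom (Fin m) s → Fin m → Bool
bit point     a i = marker a i
bit set       R i = R (i ∷ [])
bit order     _ _ = false
bit (empty k) _ _ = false

_at_ : ∀ {Γ s} → Letter Γ → s ∈ Γ → Bool
l at v = All.lookup l v

module _ {n : ℕ} where

  label : ∀ {Γ} → All Role Γ → Env (Fin (suc n)) Γ → Word (Letter Γ) (suc n)
  label []      []      i = []
  label (r ∷ ρ) (d ∷ e) i = bit r d i ∷ label ρ e i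

  label-at : ∀ {Γ s} (ρ : All Role Γ) (e : Env (Fin (suc n)) Γ) i (v : s ∈ Γ) →
             label ρ e i at v ≡ bit (All.lookup ρ v) (All.lookup e v) i
  label-at (r ∷ ρ) (d ∷ e) i (here refl) = refl
  label-at (r ∷ ρ) (d ∷ e) i (there v)   = label-at ρ e i v

  standardOrder : Vec (Fin (suc n)) 2 → Bool
  standardOrder (a ∷ b ∷ []) = does (a Fin.≤? b)

  Fits : ∀ {s} → Role s → Dom (Fin (suc n)) s → Set
  Fits point     _ = ⊤
  Fits set       _ = ⊤
  Fits order     R = R ≗ standardOrder
  Fits (empty k) R = R ≗ const false

  Conforms : ∀ {Γ} → All Role Γ → Env (Fin (suc n)) Γ → Set
  Conforms {Γ} ρ e = ∀ {s} (v : s ∈ Γ) → Fits (All.lookup ρ v) (All.lookup e v)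

  conforms-∷ : ∀ {Γ s} {ρ : All Role Γ} {e} {r : Role s} {d} →
               Fits r d → Conforms ρ e → Conforms (r ∷ ρ) (d ∷ e)
  conforms-∷ fits conforms (here refl) = fits
  conforms-∷ fits conforms (there v)   = conforms v

  conforms-lookup : ∀ {Γ s} {ρ : All Role Γ} {e} → Conforms ρ e →
                    ∀ {r : Role s} v → All.lookup ρ v ≡ r → Fits r (All.lookup e v)
  conforms-lookup conforms v refl = conforms v

Recognizes : ∀ {Γ} → All Role Γ → Fm false Γ → DFA (Letter Γ) → Set
Recognizes {Γ} ρ φ A = ∀ n (e : Env (Fin (suc n)) Γ) → Conforms ρ e → Sat n e φ ⇔ Accepts A (label ρ e)

module _ {n Γ} (ρ : All Role Γ) (e : Env (Fin (suc n)) Γ) where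

  marks-point : ∀ (v : fo ∈ Γ) i → T (label ρ e i at v) ⇔ i ≡ All.lookup e v
  marks-point v i rewrite label-at ρ e i v with All.lookup ρ v
  ... | point = ⇔-trans T-≡ marker-true

  marks-set : ∀ (v : so 1 ∈ Γ) → All.lookup ρ v ≡ set → ∀ i →
              T (label ρ e i at v) ⇔ All.lookup e v (i ∷ []) ≡ true
  marks-set v role i rewrite label-at ρ e i v | role = T-≡

  somewhere-point : ∀ (v : fo ∈ Γ) {P : Fin (suc n) → Set} →
                    (Σ (Fin (suc n)) λ i → T (label ρ e i at v) × P i) ⇔ P (All.lookup e v)
  somewhere-point v {P} = mk⇔ (λ (i , marked , Pi) → subst P (to (marks-point v i) marked) Pi)
                              (λ P[v] → All.lookup e v , from (marks-point v _) refl , P[v])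

  accepts-somewhere-at : ∀ (x : fo ∈ Γ) {s} (v : s ∈ Γ) →
    Accepts (somewhere λ l → l at x ∧ l at v) (label ρ e) ⇔ T (label ρ e (All.lookup e x) at v)
  accepts-somewhere-at x v =
    ⇔-trans (accepts-somewhere _ (label ρ e)) (⇔-trans (Σ-cong′ λ i → T-∧) (somewhere-point x))

module _ {Γ} (ρ : All Role Γ) where

  recognize-eq : ∀ x y → Recognizes ρ (eq x y) (somewhere λ l → l at x ∧ l at y)
  recognize-eq x y n e _ = ⇔-sym (⇔-trans (accepts-somewhere-at ρ e x y) (marks-point ρ e y _))

  recognize-set : ∀ X x → All.lookup ρ X ≡ set →
                  Recognizes ρ (rel X (x ∷ [])) (somewhere λ l → l at x ∧ l at X)
  recognize-set X x role n e _ = ⇔-sym (⇔-trans (accepts-somewhere-at ρ e x X) (marks-set ρ e X role _))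

  recognize-order : ∀ X x y → All.lookup ρ X ≡ order →
                    Recognizes ρ (rel X (x ∷ y ∷ [])) (ordered (_at x) (_at y))
  recognize-order X x y role n e conforms = ⇔-sym (begin
    Accepts (ordered _ _) (label ρ e)
      ≈⟨ accepts-ordered _ _ (label ρ e) ⟩
    (Σ (Fin (suc n)) λ i → Σ (Fin (suc n)) λ j → i Fin.≤ j × T (label ρ e i at x) × T (label ρ e j at y))
      ≈⟨ mk⇔ (λ (i , j , i≤j , xi , yj) →
                 subst₂ Fin._≤_ (to (marks-point ρ e x i) xi) (to (marks-point ρ e y j) yj) i≤j)
             (λ x≤y → _ , _ , x≤y , from (marks-point ρ e x _) refl , from (marks-point ρ e y _) refl) ⟩
    All.lookup e x Fin.≤ All.lookup e y
      ≈⟨ ⇔-trans (⇔-sym (T-does (_ Fin.≤? _))) T-≡ ⟩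
    standardOrder (All.lookup e x ∷ All.lookup e y ∷ []) ≡ true
      ≈⟨ ≡⇒⇔ (cong (_≡ true) (sym (conforms-lookup {ρ = ρ} {e} conforms X role _))) ⟩
    All.lookup e X (All.lookup e x ∷ All.lookup e y ∷ []) ≡ true
      ∎)
    where open ⇔-Reasoning

  recognize-empty : ∀ {k} X (xs : Vec (fo ∈ Γ) k) → All.lookup ρ X ≡ empty k →
                    Recognizes ρ (rel X xs) (somewhere (const false))
  recognize-empty X xs role n e conforms = mk⇔
    (λ related → contradiction (trans (sym (conforms-lookup {ρ = ρ} {e} conforms X role _)) related) λ ())
    (λ accepted → contradiction (proj₂ (to (accepts-somewhere _ (label ρ e)) accepted)) λ ())

  recognize-rel : ∀ {k} X (xs : Vec (fo ∈ Γ) k) (r : Role (so k)) → All.lookup ρ X ≡ r →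
                  Σ (DFA (Letter Γ)) (Recognizes ρ (rel X xs))
  recognize-rel X (x ∷ [])     set       role = somewhere (λ l → l at x ∧ l at X) , recognize-set X x role
  recognize-rel X (x ∷ y ∷ []) order     role = ordered (_at x) (_at y) , recognize-order X x y role
  recognize-rel X xs           (empty k) role = somewhere (const false) , recognize-empty X xs role

Σ-marker⇔Σ-singleton : ∀ {m} {P : (Fin m → Bool) → Set} → (∀ {g g′} → g ≗ g′ → P g → P g′) →
                       (Σ (Fin m) λ a → P (marker a)) ⇔ (Σ (Fin m → Bool) λ g → P g × count g ≡ 1)
Σ-marker⇔Σ-singleton respects = mk⇔
  (λ (a , Pa) → marker a , Pa , count-singleton {c = a} λ _ → marker-true)
  (λ (g , Pg , count≡1) → let (c , g⇔c) = count≡1⇒singleton count≡1 in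
    c , respects (λ i → true-⇔⇒≡ (⇔-trans (g⇔c i) (⇔-sym marker-true))) Pg)

extend : ∀ {Γ s} → Bool → Letter Γ → Letter (s ∷ Γ)
extend b l = b ∷ l

accepts-marked-cong : ∀ {Γ s m} (A : DFA (Letter (s ∷ Γ))) (w : Word (Letter Γ) m) {g g′} → g ≗ g′ →
                      Accepts A (Marked extend g w) → Accepts A (Marked extend g′ w)
accepts-marked-cong A w g≗g′ = subst (T ∘ accepting A) (run-cong A _ λ i → cong (λ b → b ∷ w i) (g≗g′ i))

module _ {Γ} (ρ : All Role Γ) where

  recognize-neg : ∀ {φ A} → Recognizes ρ φ A → Recognizes ρ (neg φ) (complement A)
  recognize-neg {A = A} recognizes n e conforms =
    ⇔-trans (¬-cong-⇔ (recognizes n e conforms)) (⇔-sym (accepts-complement A (label ρ e)))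

  recognize-or : ∀ {φ ψ A B} → Recognizes ρ φ A → Recognizes ρ ψ B → Recognizes ρ (or φ ψ) (product _∨_ A B)
  recognize-or {A = A} {B} recognizesφ recognizesψ n e conforms =
    ⇔-trans (recognizesφ n e conforms ⊎-⇔ recognizesψ n e conforms) (⇔-sym (accepts-union A B (label ρ e)))

  recognize-ex1 : ∀ {φ A} → Recognizes (point ∷ ρ) φ A →
                  Recognizes ρ (ex1 φ) (project extend (product _∧_ A (exactlyOne All.head)))
  recognize-ex1 {φ} {A} recognizes n e conforms = begin
    (Σ (Fin (suc n)) λ a → Sat n (a ∷ e) φ)
      ≈⟨ Σ-cong′ (λ a → recognizes n (a ∷ e) (conforms-∷ tt conforms)) ⟩
    (Σ (Fin (suc n)) λ a → Accepts A (marked (marker a)))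
      ≈⟨ Σ-marker⇔Σ-singleton (accepts-marked-cong A (label ρ e)) ⟩
    (Σ (Fin (suc n) → Bool) λ g → Accepts A (marked g) × count g ≡ 1)
      ≈⟨ Σ-cong′ (λ g → ⇔-sym (⇔-trans (accepts-intersection A (exactlyOne All.head) (marked g))
                                       (⇔-refl ×-⇔ accepts-exactlyOne All.head (marked g)))) ⟩
    (Σ (Fin (suc n) → Bool) λ g → Accepts (product _∧_ A (exactlyOne All.head)) (marked g))
      ≈⟨ ⇔-sym (accepts-project extend (product _∧_ A (exactlyOne All.head)) (label ρ e)) ⟩
    Accepts (project extend (product _∧_ A (exactlyOne All.head))) (label ρ e)
      ∎
    where
    open ⇔-Reasoning
    marked : (Fin (suc n) → Bool) → Word (Letter (fo ∷ Γ)) (suc n)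
    marked g = Marked extend g (label ρ e)

  recognize-ex2 : ∀ {φ A} → Recognizes (set ∷ ρ) φ A → Recognizes ρ (ex2 φ) (project extend A)
  recognize-ex2 {A = A} recognizes n e conforms = ⇔-trans
    (mk⇔ (λ (R , sat) → (λ i → R (i ∷ [])) , to (recognizes n (R ∷ e) (conforms-∷ tt conforms)) sat)
         (λ (g , acc) → g ∘ Vec.head , from (recognizes n (g ∘ Vec.head ∷ e) (conforms-∷ tt conforms)) acc))
    (⇔-sym (accepts-project extend A (label ρ e)))

translate : ∀ {Γ} (ρ : All Role Γ) (φ : Fm false Γ) → Σ (DFA (Letter Γ)) (Recognizes ρ φ)
translate ρ (eq x y)   = somewhere (λ l → l at x ∧ l at y) , recognize-eq ρ x y
translate ρ (rel X xs) = recognize-rel ρ X xs (All.lookup ρ X) refl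
translate ρ (neg φ) with translate ρ φ
... | A , recognizes = complement A , recognize-neg ρ {φ} {A} recognizes
translate ρ (or φ ψ) with translate ρ φ | translate ρ ψ
... | A , recognizesφ | B , recognizesψ = product _∨_ A B , recognize-or ρ {φ} {ψ} {A} {B} recognizesφ recognizesψ
translate ρ (ex1 φ) with translate (point ∷ ρ) φ
... | A , recognizes = project extend (product _∧_ A (exactlyOne All.head)) , recognize-ex1 ρ {φ} {A} recognizes
translate ρ (ex2 φ) with translate (set ∷ ρ) φ
... | A , recognizes = project extend A , recognize-ex2 ρ {φ} {A} recognizes

blankRoles : ∀ τ → All Role τ
blankRoles []         = []
blankRoles (fo ∷ τ)   = point ∷ blankRoles τ
blankRoles (so k ∷ τ) = empty k ∷ blankRoles τ

blank : ∀ n τ → Env (Fin (suc n)) τ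
blank n []         = []
blank n (fo ∷ τ)   = zero ∷ blank n τ
blank n (so k ∷ τ) = const false ∷ blank n τ

blankLetter : ∀ τ → Bool → Letter τ
blankLetter []         _ = []
blankLetter (fo ∷ τ)   b = b ∷ blankLetter τ b
blankLetter (so k ∷ τ) b = false ∷ blankLetter τ b

module _ {n : ℕ} where

  blank-conforms : ∀ τ → Conforms (order ∷ blankRoles τ) (standardOrder ∷ blank n τ)
  blank-conforms τ          (here refl)         = λ _ → refl
  blank-conforms (fo ∷ τ)   (there (here refl)) = tt
  blank-conforms (so k ∷ τ) (there (here refl)) = λ _ → refl
  blank-conforms (fo ∷ τ)   (there (there v))   = blank-conforms τ (there v)
  blank-conforms (so k ∷ τ) (there (there v))   = blank-conforms τ (there v)

  label-blank-zero : ∀ τ → label (blankRoles τ) (blank n τ) zero ≡ blankLetter τ true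
  label-blank-zero []         = refl
  label-blank-zero (fo ∷ τ)   = cong (true ∷_) (label-blank-zero τ)
  label-blank-zero (so k ∷ τ) = cong (false ∷_) (label-blank-zero τ)

  label-blank-suc : ∀ τ i → label (blankRoles τ) (blank n τ) (suc i) ≡ blankLetter τ false
  label-blank-suc []         i = refl
  label-blank-suc (fo ∷ τ)   i = cong (false ∷_) (label-blank-suc τ i)
  label-blank-suc (so k ∷ τ) i = cong (false ∷_) (label-blank-suc τ i)

-- On these structures the word read by the automaton is a₀ a₁ⁿ.
ultimatelyPeriodic-blank : ∀ τ (ψ : Fm false (τ ≤voc)) →
                           UltimatelyPeriodic (λ n → Sat n (standardOrder ∷ blank n τ) ψ)
ultimatelyPeriodic-blank τ ψ with translate (order ∷ blankRoles τ) ψ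
... | A , recognizes = ultimatelyPeriodic-cong sat⇔accepts (ultimatelyPeriodic-iterate A a₁ q₁)
  where
  a₀ a₁ : Letter (τ ≤voc)
  a₀ = false ∷ blankLetter τ true
  a₁ = false ∷ blankLetter τ false
  q₁ = step A (start A) a₀
  sat⇔accepts : ∀ n → Sat n (standardOrder ∷ blank n τ) ψ ⇔ T (accepting A (iterate A a₁ q₁ n))
  sat⇔accepts n = ⇔-trans (recognizes n _ (blank-conforms τ)) (≡⇒⇔ (cong (T ∘ accepting A) run-word))
    where
    word = label (order ∷ blankRoles τ) (standardOrder ∷ blank n τ)
    run-word : run A (start A) word ≡ iterate A a₁ q₁ n
    run-word = begin
      run A (step A (start A) (word zero)) (word ∘ suc)
        ≡⟨ cong (λ l → run A (step A (start A) (false ∷ l)) (word ∘ suc)) (label-blank-zero τ) ⟩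
      run A q₁ (word ∘ suc)
        ≡⟨ run-cong A q₁ (cong (false ∷_) ∘ label-blank-suc {n} τ) ⟩
      iterate A a₁ q₁ n
        ∎
      where open ≡-Reasoning

-- An MSO(TC) sentence for triangular size

pattern #0 = here refl
pattern #1 = there #0
pattern #2 = there #1
pattern #3 = there #2
pattern #4 = there #3
pattern #5 = there #4
pattern #6 = there #5
pattern #7 = there #6

infixr 6 _∧ᶠ_
infix  7 _⇔ᶠ_

_∧ᶠ_ : ∀ {b Γ} → Fm b Γ → Fm b Γ → Fm b Γ
φ ∧ᶠ ψ = neg (or (neg φ) (neg ψ))

_⇒ᶠ_ : ∀ {b Γ} → Fm b Γ → Fm b Γ → Fm b Γ
φ ⇒ᶠ ψ = or (neg φ) ψ

_⇔ᶠ_ : ∀ {b Γ} → Fm b Γ → Fm b Γ → Fm b Γ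
φ ⇔ᶠ ψ = (φ ⇒ᶠ ψ) ∧ᶠ (ψ ⇒ᶠ φ)

∀ᶠ : ∀ {b Γ} → Fm b (fo ∷ Γ) → Fm b Γ
∀ᶠ φ = neg (ex1 (neg φ))

member : ∀ {b Γ} → so 1 ∈ Γ → fo ∈ Γ → Fm b Γ
member X x = rel X (x ∷ [])

sameSet : ∀ {b Γ} → so 1 ∈ Γ → so 1 ∈ Γ → Fm b Γ
sameSet X Y = ∀ᶠ (member (there X) #0 ⇔ᶠ member (there Y) #0)

inserts : ∀ {b Γ} → so 1 ∈ Γ → so 1 ∈ Γ → fo ∈ Γ → Fm b Γ
inserts X′ X c = ∀ᶠ (member (there X′) #0 ⇔ᶠ or (member (there X) #0) (eq #0 (there c)))

isEmpty : ∀ {b Γ} → so 1 ∈ Γ → Fm b Γ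
isEmpty X = ∀ᶠ (neg (member (there X) #0))

isFull : ∀ {b Γ} → so 1 ∈ Γ → Fm b Γ
isFull X = ∀ᶠ (member (there X) #0)

module _ {A : Set} where

  _∋_ : Dom A (so 1) → A → Set
  R ∋ a = R (a ∷ []) ≡ true

  SameSet : Dom A (so 1) → Dom A (so 1) → Set
  SameSet R R′ = ∀ a → R ∋ a ⇔ R′ ∋ a

  Inserts : Dom A (so 1) → Dom A (so 1) → A → Set
  Inserts R′ R c = ∀ a → R′ ∋ a ⇔ (R ∋ a ⊎ a ≡ c)

  IsEmpty : Dom A (so 1) → Set
  IsEmpty R = ∀ a → ¬ R ∋ a

  IsFull : Dom A (so 1) → Set
  IsFull R = ∀ a → R ∋ a

sat-⇔ᶠ : ∀ {n b Γ} {e : Env (Fin (suc n)) Γ} {φ ψ : Fm b Γ} →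
         Sat n e (φ ⇔ᶠ ψ) ⇔ᶜ (Sat n e φ ⇔ Sat n e ψ)
sat-⇔ᶠ = ⇔ᶜ-trans (¬⊎¬-congᶜ ¬⊎⇔ᶜ→ ¬⊎⇔ᶜ→)
                  (⇔⇒⇔ᶜ (mk⇔ (λ (f , g) → mk⇔ f g) (λ φ⇔ψ → to φ⇔ψ , from φ⇔ψ)))

sat-∀ᶠ : ∀ {n b Γ} {e : Env (Fin (suc n)) Γ} {φ : Fm b (fo ∷ Γ)} →
         Sat n e (∀ᶠ φ) ⇔ᶜ (∀ a → Sat n (a ∷ e) φ)
sat-∀ᶠ = ¬∃¬⇔ᶜ∀

module _ {n : ℕ} {b : Bool} {Γ : List Sort} (e : Env (Fin (suc n)) Γ) where

  sat-sameSet : ∀ X Y → Sat n e (sameSet {b} X Y) ⇔ᶜ SameSet (All.lookup e X) (All.lookup e Y)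
  sat-sameSet X Y =
    ⇔ᶜ-trans (sat-∀ᶠ {e = e} {φ = φ ⇔ᶠ ψ}) (∀-Fin-congᶜ λ a → sat-⇔ᶠ {e = a ∷ e} {φ = φ} {ψ})
    where
    φ ψ : Fm b (fo ∷ Γ)
    φ = member (there X) #0
    ψ = member (there Y) #0

  sat-inserts : ∀ X′ X c →
    Sat n e (inserts {b} X′ X c) ⇔ᶜ Inserts (All.lookup e X′) (All.lookup e X) (All.lookup e c)
  sat-inserts X′ X c =
    ⇔ᶜ-trans (sat-∀ᶠ {e = e} {φ = φ ⇔ᶠ ψ}) (∀-Fin-congᶜ λ a → sat-⇔ᶠ {e = a ∷ e} {φ = φ} {ψ})
    where
    φ ψ : Fm b (fo ∷ Γ)
    φ = member (there X′) #0
    ψ = or (member (there X) #0) (eq #0 (there c))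

  sat-isEmpty : ∀ X → Sat n e (isEmpty {b} X) ⇔ᶜ IsEmpty (All.lookup e X)
  sat-isEmpty X = sat-∀ᶠ {b = b} {e = e} {φ = neg (member (there X) #0)}

  sat-isFull : ∀ X → Sat n e (isFull {b} X) ⇔ᶜ IsFull (All.lookup e X)
  sat-isFull X = sat-∀ᶠ {b = b} {e = e} {φ = member (there X) #0}

counterSorts : List Sort
counterSorts = so 1 ∷ so 1 ∷ so 1 ∷ []

counterSorts-monadic : All Monadic counterSorts
counterSorts-monadic = so-mon ∷ so-mon ∷ so-mon ∷ []

-- In the body of the transitive closure, #0 #1 #2 are X C S and #3 #4 #5 are X′ C′ S′.
countStep : ∀ {Γ} → Fm true (counterSorts ++ (counterSorts ++ Γ))
countStep = sameSet #3 #0 ∧ᶠ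
  ex1 (ex1 (member #2 #1 ∧ᶠ neg (member #3 #1) ∧ᶠ neg (member #4 #0) ∧ᶠ inserts #6 #3 #1 ∧ᶠ inserts #7 #4 #0))

roundStep : ∀ {Γ} → Fm true (counterSorts ++ (counterSorts ++ Γ))
roundStep = sameSet #1 #0 ∧ᶠ sameSet #5 #2 ∧ᶠ isEmpty #4 ∧ᶠ ex1 (neg (member #1 #0) ∧ᶠ inserts #4 #1 #0)

countingRun : ∀ {Γ} → Fm true (so 1 ∷ so 1 ∷ so 1 ∷ so 1 ∷ Γ)
countingRun = isEmpty #0 ∧ᶠ isFull #1 ∧ᶠ sameSet #2 #3 ∧ᶠ
  tc counterSorts counterSorts-monadic (or countStep roundStep) (#0 ∷ #0 ∷ #0 ∷ []) (#3 ∷ #2 ∷ #1 ∷ [])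

triangularSize : ∀ {Γ} → Fm true Γ
triangularSize = ex2 (ex2 (ex2 (ex2 countingRun)))

module _ {n : ℕ} where

  Counter : Set
  Counter = All (Dom (Fin (suc n))) counterSorts

  CountStep : Counter → Counter → Set
  CountStep (X ∷ C ∷ S ∷ []) (X′ ∷ C′ ∷ S′ ∷ []) =
    SameSet X′ X × Σ (Fin (suc n)) λ c → Σ (Fin (suc n)) λ s →
      X ∋ c × ¬ C ∋ c × ¬ S ∋ s × Inserts C′ C c × Inserts S′ S s

  RoundStep : Counter → Counter → Set
  RoundStep (X ∷ C ∷ S ∷ []) (X′ ∷ C′ ∷ S′ ∷ []) =
    SameSet C X × SameSet S′ S × IsEmpty C′ × Σ (Fin (suc n)) λ x → ¬ X ∋ x × Inserts X′ X x

  module _ {Γ} (e : Env (Fin (suc n)) Γ) where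

    CounterStep : Counter → Counter → Set
    CounterStep u u′ = Sat n (++⁺ u (++⁺ u′ e)) (or countStep roundStep)

    sat-countStep : ∀ u u′ → Sat n (++⁺ u (++⁺ u′ e)) countStep ⇔ᶜ CountStep u u′
    sat-countStep (X ∷ C ∷ S ∷ []) (X′ ∷ C′ ∷ S′ ∷ []) =
      ¬⊎¬-congᶜ (sat-sameSet {b = true} env #3 #0) (Σ-congᶜ λ c → Σ-congᶜ λ s →
        ¬⊎¬-congᶜ ⇔ᶜ-refl (¬⊎¬-congᶜ ⇔ᶜ-refl (¬⊎¬-congᶜ ⇔ᶜ-refl
          (¬⊎¬-congᶜ (sat-inserts {b = true} (s ∷ c ∷ env) #6 #3 #1)
                     (sat-inserts {b = true} (s ∷ c ∷ env) #7 #4 #0)))))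
      where env = X ∷ C ∷ S ∷ X′ ∷ C′ ∷ S′ ∷ e

    sat-roundStep : ∀ u u′ → Sat n (++⁺ u (++⁺ u′ e)) roundStep ⇔ᶜ RoundStep u u′
    sat-roundStep (X ∷ C ∷ S ∷ []) (X′ ∷ C′ ∷ S′ ∷ []) =
      ¬⊎¬-congᶜ (sat-sameSet {b = true} env #1 #0) (¬⊎¬-congᶜ (sat-sameSet {b = true} env #5 #2)
        (¬⊎¬-congᶜ (sat-isEmpty {b = true} env #4)
          (Σ-congᶜ λ x → ¬⊎¬-congᶜ ⇔ᶜ-refl (sat-inserts {b = true} (x ∷ env) #4 #1 #0))))
      where env = X ∷ C ∷ S ∷ X′ ∷ C′ ∷ S′ ∷ e

    sat-counterStep : ∀ u u′ → CounterStep u u′ ⇔ᶜ (CountStep u u′ ⊎ RoundStep u u′)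
    sat-counterStep u u′ = ⊎-congᶜ (sat-countStep u u′) (sat-roundStep u u′)

  ∣_∣ : Dom (Fin (suc n)) (so 1) → ℕ
  ∣ R ∣ = count (λ a → R (a ∷ []))

  -- X counts the finished rounds and C the progress of the current round; S grows at every
  -- counting step, so once C has caught up with X the invariant says |S| = T(|X|).
  Balanced : Counter → Set
  Balanced (X ∷ C ∷ S ∷ []) = ∣ S ∣ + ∣ X ∣ ≡ triangle ∣ X ∣ + ∣ C ∣

  countStep-balanced : ∀ u u′ → CountStep u u′ → Balanced u → Balanced u′
  countStep-balanced (X ∷ C ∷ S ∷ []) (X′ ∷ C′ ∷ S′ ∷ [])
                     (X′≈X , c , s , _ , c∉C , s∉S , C′≈C+c , S′≈S+s) balanced = begin
    ∣ S′ ∣ + ∣ X′ ∣               ≡⟨ cong₂ _+_ (count-insert S′≈S+s s∉S) (count-cong X′≈X) ⟩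
    suc (∣ S ∣ + ∣ X ∣)           ≡⟨ cong suc balanced ⟩
    suc (triangle ∣ X ∣ + ∣ C ∣)  ≡⟨ sym (+-suc _ _) ⟩
    triangle ∣ X ∣ + suc ∣ C ∣    ≡⟨ cong₂ (λ x c → triangle x + c) (sym (count-cong X′≈X))
                                                                 (sym (count-insert C′≈C+c c∉C)) ⟩
    triangle ∣ X′ ∣ + ∣ C′ ∣      ∎
    where open ≡-Reasoning

  roundStep-balanced : ∀ u u′ → RoundStep u u′ → Balanced u → Balanced u′
  roundStep-balanced (X ∷ C ∷ S ∷ []) (X′ ∷ C′ ∷ S′ ∷ [])
                     (C≈X , S′≈S , C′-empty , x , x∉X , X′≈X+x) balanced = begin
    ∣ S′ ∣ + ∣ X′ ∣               ≡⟨ cong₂ _+_ (count-cong S′≈S) (count-insert X′≈X+x x∉X) ⟩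
    ∣ S ∣ + suc ∣ X ∣             ≡⟨ cong (_+ suc ∣ X ∣) S-triangular ⟩
    triangle ∣ X ∣ + suc ∣ X ∣    ≡⟨ +-comm _ (suc ∣ X ∣) ⟩
    triangle (suc ∣ X ∣)          ≡⟨ sym (+-identityʳ _) ⟩
    triangle (suc ∣ X ∣) + 0      ≡⟨ cong₂ (λ x c → triangle x + c) (sym (count-insert X′≈X+x x∉X))
                                                                   (sym (count-none C′-empty)) ⟩
    triangle ∣ X′ ∣ + ∣ C′ ∣      ∎
    where
    open ≡-Reasoning
    S-triangular : ∣ S ∣ ≡ triangle ∣ X ∣
    S-triangular = +-cancelʳ-≡ ∣ X ∣ _ _ (trans balanced (cong (triangle ∣ X ∣ +_) (count-cong C≈X)))

  module _ {Γ} (e : Env (Fin (suc n)) Γ) where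

    counterStep-balanced : ∀ u u′ → CounterStep e u u′ → Balanced u → Balanced u′
    counterStep-balanced u u′@(_ ∷ _ ∷ _ ∷ []) step balanced = decidable-stable (_ ≟ _) (¬¬-map
      Sum.[ (λ count → countStep-balanced u u′ count balanced)
          , (λ round → roundStep-balanced u u′ round balanced) ]
      (toᶜ (sat-counterStep e u u′) step))

    reachable-balanced : ∀ {u u′} → TransClosure (CounterStep e) u u′ → Balanced u → Balanced u′
    reachable-balanced [ step ]      = counterStep-balanced _ _ step
    reachable-balanced (step ∷ rest) = reachable-balanced rest ∘ counterStep-balanced _ _ step

  module _ {Γ} (e : Env (Fin (suc n)) Γ) where

    CountingRun : (X C S E : Dom (Fin (suc n)) (so 1)) → Set
    CountingRun X C S E = IsEmpty E × IsFull S × SameSet C X ×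
      TransClosure (CounterStep (E ∷ S ∷ C ∷ X ∷ e)) (E ∷ E ∷ E ∷ []) (X ∷ C ∷ S ∷ [])

    sat-countingRun : ∀ X C S E → Sat n (E ∷ S ∷ C ∷ X ∷ e) countingRun ⇔ᶜ CountingRun X C S E
    sat-countingRun X C S E =
      ¬⊎¬-congᶜ (sat-isEmpty {b = true} env #0)
        (¬⊎¬-congᶜ (sat-isFull {b = true} env #1) (¬⊎¬-congᶜ (sat-sameSet {b = true} env #2 #3) ⇔ᶜ-refl))
      where env = E ∷ S ∷ C ∷ X ∷ e

    countingRun-triangular : ∀ {X C S E} → CountingRun X C S E → suc n ≡ triangle ∣ X ∣
    countingRun-triangular {X} {C} {S} {E} (E-empty , S-full , C≈X , reach) = +-cancelʳ-≡ ∣ X ∣ _ _ (begin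
      suc n + ∣ X ∣            ≡⟨ cong (_+ ∣ X ∣) (sym (count-all S-full)) ⟩
      ∣ S ∣ + ∣ X ∣            ≡⟨ reachable-balanced (E ∷ S ∷ C ∷ X ∷ e) reach initial ⟩
      triangle ∣ X ∣ + ∣ C ∣   ≡⟨ cong (triangle ∣ X ∣ +_) (count-cong C≈X) ⟩
      triangle ∣ X ∣ + ∣ X ∣   ∎)
      where
      open ≡-Reasoning
      initial : Balanced (E ∷ E ∷ E ∷ [])
      initial rewrite count-none E-empty = refl

    triangularSize-sound : Sat n e triangularSize → Triangular (suc n)
    triangularSize-sound (X , C , S , E , run) =
      ∣ X ∣ , decidable-stable (_ ≟ _) (¬¬-map countingRun-triangular (toᶜ (sat-countingRun X C S E) run))

module _ {n : ℕ} where

  segment : ℕ → Dom (Fin (suc n)) (so 1)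
  segment t (a ∷ []) = does (toℕ a <? t)

  segment-∋ : ∀ {t a} → segment t ∋ a ⇔ toℕ a < t
  segment-∋ {t} {a} = ⇔-trans (⇔-sym T-≡) (T-does (toℕ a <? t))

  segment-zero-empty : IsEmpty (segment 0)
  segment-zero-empty a a∈0 = n≮0 (to (segment-∋ {0} {a}) a∈0)

  segment-full : ∀ {t} → suc n ≤ t → IsFull (segment t)
  segment-full n<t a = from segment-∋ (<-≤-trans (toℕ<n a) n<t)

  segment-∌ : ∀ {t} (t<1+n : t < suc n) → ¬ segment t ∋ fromℕ< t<1+n
  segment-∌ t<1+n t∈t = <-irrefl (toℕ-fromℕ< t<1+n) (to segment-∋ t∈t)

  segment-∋-fromℕ< : ∀ {t x} (t<1+n : t < suc n) → t < x → segment x ∋ fromℕ< t<1+n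
  segment-∋-fromℕ< t<1+n t<x = from segment-∋ (subst (_< _) (sym (toℕ-fromℕ< t<1+n)) t<x)

  segment-suc : ∀ {t} (t<1+n : t < suc n) → Inserts (segment (suc t)) (segment t) (fromℕ< t<1+n)
  segment-suc {t} t<1+n a = mk⇔
    (Sum.map (from (segment-∋ {t} {a})) (λ a≡t → toℕ-injective (trans a≡t (sym (toℕ-fromℕ< t<1+n))))
      ∘ m<1+n⇒m<n∨m≡n ∘ to (segment-∋ {suc t} {a}))
    (from (segment-∋ {suc t} {a}) ∘ Sum.[ (λ a∈t → ≤-trans (to (segment-∋ {t} {a}) a∈t) (n≤1+n t))
                                        , (λ { refl → s≤s (≤-reflexive (toℕ-fromℕ< t<1+n)) }) ])

  counter : ℕ → ℕ → ℕ → Counter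
  counter x c s = segment x ∷ segment c ∷ segment s ∷ []

  countStep-segments : ∀ {x c s} → c < x → x ≤ suc n → s < suc n →
                       CountStep (counter x c s) (counter x (suc c) (suc s))
  countStep-segments c<x x≤1+n s<1+n =
    (λ _ → ⇔-refl) , fromℕ< c<1+n , fromℕ< s<1+n , segment-∋-fromℕ< c<1+n c<x ,
    segment-∌ c<1+n , segment-∌ s<1+n , segment-suc c<1+n , segment-suc s<1+n
    where c<1+n = <-≤-trans c<x x≤1+n

  roundStep-segments : ∀ {x s} → x < suc n → RoundStep (counter x x s) (counter (suc x) 0 s)
  roundStep-segments x<1+n =
    (λ _ → ⇔-refl) , (λ _ → ⇔-refl) , segment-zero-empty , fromℕ< x<1+n , segment-∌ x<1+n , segment-suc x<1+n

  module _ {Γ} (e : Env (Fin (suc n)) Γ) where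

    _⟶⁺_ : Counter → Counter → Set
    _⟶⁺_ = TransClosure (CounterStep e)

    countStep-holds : ∀ {x c s} → c < x → x ≤ suc n → s < suc n →
                      CounterStep e (counter x c s) (counter x (suc c) (suc s))
    countStep-holds {x} {c} {s} c<x x≤1+n s<1+n = inj₁ (negated-stable
      (fromᶜ (sat-countStep e (counter x c s) (counter x (suc c) (suc s))) (countStep-segments c<x x≤1+n s<1+n)))

    roundStep-holds : ∀ {x s} → x < suc n → CounterStep e (counter x x s) (counter (suc x) 0 s)
    roundStep-holds {x} {s} x<1+n = inj₂ (negated-stable
      (fromᶜ (sat-roundStep e (counter x x s) (counter (suc x) 0 s)) (roundStep-segments {s = s} x<1+n)))

    counting : ∀ d {x c s} → d + c < x → x ≤ suc n → d + s < suc n →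
               counter x c s ⟶⁺ counter x (suc d + c) (suc d + s)
    counting zero    c<x   x≤1+n s<1+n   = [ countStep-holds c<x x≤1+n s<1+n ]
    counting (suc d) d+c<x x≤1+n d+s<1+n =
      counting d (<⇒≤ d+c<x) x≤1+n (<⇒≤ d+s<1+n) ∷ʳ countStep-holds d+c<x x≤1+n d+s<1+n

    round : ∀ r → triangle (suc r) ≤ suc n →
            counter r r (triangle r) ⟶⁺ counter (suc r) (suc r) (triangle (suc r))
    round r fits = subst (λ c → counter r r (triangle r) ⟶⁺ counter (suc r) c (triangle (suc r)))
                         (+-identityʳ (suc r))
      (roundStep-holds {s = triangle r} r<1+n ∷
       counting r (s≤s (≤-reflexive (+-identityʳ r))) (≤-trans (m≤m+n (suc r) (triangle r)) fits) fits)
      where r<1+n = <-≤-trans (s≤s (m≤m+n r (triangle r))) fits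

    rounds : ∀ k → triangle (suc k) ≤ suc n → counter 0 0 0 ⟶⁺ counter (suc k) (suc k) (triangle (suc k))
    rounds zero    fits = round 0 fits
    rounds (suc k) fits = rounds k (≤-trans (m≤n+m (triangle (suc k)) (suc (suc k))) fits) ⁺++ round (suc k) fits

  triangularSize-complete : ∀ {Γ} (e : Env (Fin (suc n)) Γ) → Triangular (suc n) → Sat n e triangularSize
  triangularSize-complete e (suc k , 1+n≡T) = X , X , S , segment 0 ,
    negated-stable (fromᶜ (sat-countingRun e X X S (segment 0))
      (segment-zero-empty , segment-full (≤-reflexive 1+n≡T) , (λ _ → ⇔-refl) ,
       rounds (segment 0 ∷ S ∷ X ∷ X ∷ e) k (≤-reflexive (sym 1+n≡T))))
    where
    X = segment (suc k)
    S = segment (triangle (suc k))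

triangularSize-defines : ∀ {n Γ} (e : Env (Fin (suc n)) Γ) → Sat n e triangularSize ⇔ Triangular (suc n)
triangularSize-defines e = mk⇔ (triangularSize-sound e) (triangularSize-complete e)

standardOrder-linear : ∀ {n} → IsLinearOrder (standardOrder {n})
standardOrder-linear = record
  { refl′   = λ a → from (≤⇔ a a) Fin.≤-refl
  ; antisym = λ a b a≤b b≤a → Fin.≤-antisym (to (≤⇔ a b) a≤b) (to (≤⇔ b a) b≤a)
  ; trans′  = λ a b c a≤b b≤c → from (≤⇔ a c) (Fin.≤-trans (to (≤⇔ a b) a≤b) (to (≤⇔ b c) b≤c))
  ; total   = λ a b → Sum.map (from (≤⇔ a b)) (from (≤⇔ b a)) (Fin.≤-total a b)
  }
  where
  ≤⇔ : ∀ a b → a ≤[ standardOrder ] b ⇔ a Fin.≤ b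
  ≤⇔ a b = ⇔-trans (⇔-sym T-≡) (T-does (a Fin.≤? b))

mainTheorem10 : (τ : Vocabulary) →
    Σ (Class τ) λ C → DefinableMSOTC C × ¬ DefinableOIMSO C
mainTheorem10 τ = TriangularSize , (triangularSize , λ _ → ⇔-refl) , not-order-invariant
  where
  TriangularSize : Class τ
  TriangularSize s = Sat (proj₁ s) (proj₂ s) triangularSize
  not-order-invariant : ¬ DefinableOIMSO TriangularSize
  not-order-invariant (ψ , _ , defines) = triangular-not-ultimatelyPeriodic (ultimatelyPeriodic-cong
    (λ n → ⇔-trans (⇔-sym (triangularSize-defines (blank n τ)))
                   (defines n (blank n τ) standardOrder standardOrder-linear))
    (ultimatelyPeriodic-blank τ ψ))
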